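{- If $\phi$ is a formula disjunctive in $x$, then (in every Heyting algebra and under every valuation of the other variables) the least fixed point $\mu_{x}.\phi$ exists and $$\mu_{x}.\phi = \Big(\bigwedge_{\alpha \in \mathsf{Head}(\phi)} \alpha\Big) \to \Big(\bigvee_{\beta \in \mathsf{Side}(\phi)} \beta\Big).$$
   Context: Formulas are IPC formulas built from propositional variables with $\top,\bot,\land,\vee,\to$, interpreted in Heyting algebras. A formula is disjunctive in $x$ if it is generated by the grammar $\phi ::= x \mid \alpha \to \phi \mid \beta \vee \phi \mid \phi \vee \phi$, where $\alpha$ and $\beta$ do not contain $x$. $\mathsf{Head}(\phi)$ is the set of formulas $\alpha$ occurring as leaves in the production $\alpha \to \phi$ of a parse of $\phi$ (head subformulas), and $\mathsf{Side}(\phi)$ the set of formulas $\beta$ occurring in the production $\beta \vee \phi$ (side subformulas). $\mu_{x}.\phi$ denotes the least (pre)fixed point of the monotone map $h \mapsto \phi(h/x)$. -}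

module Defs where

open import Level using (Level)
open import Data.Nat using (ℕ; _≟_)
open import Data.List using (List; []; _∷_; _++_; foldr)
open import Relation.Nullary using (¬_; yes; no)
open import Relation.Binary.PropositionalEquality using (_≡_)
open import Relation.Binary.Lattice using (HeytingAlgebra)

data Fm : Set where
  var  : ℕ → Fm
  ⊤f   : Fm
  ⊥f   : Fm
  _∧f_ : Fm → Fm → Fm
  _∨f_ : Fm → Fm → Fm
  _⇒f_ : Fm → Fm → Fm

data Occurs (x : ℕ) : Fm → Set where
  here : Occurs x (var x)
  ∧l   : ∀ {a b} → Occurs x a → Occurs x (a ∧f b)
  ∧r   : ∀ {a b} → Occurs x b → Occurs x (a ∧f b)
  ∨l   : ∀ {a b} → Occurs x a → Occurs x (a ∨f b)
  ∨r   : ∀ {a b} → Occurs x b → Occurs x (a ∨f b)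
  ⇒l   : ∀ {a b} → Occurs x a → Occurs x (a ⇒f b)
  ⇒r   : ∀ {a b} → Occurs x b → Occurs x (a ⇒f b)

data Disj (x : ℕ) : Fm → Set where
  dvar : Disj x (var x)
  dimp : ∀ {α φ} → ¬ Occurs x α → Disj x φ → Disj x (α ⇒f φ)
  dside : ∀ {β φ} → ¬ Occurs x β → Disj x φ → Disj x (β ∨f φ)
  dor  : ∀ {φ ψ} → Disj x φ → Disj x ψ → Disj x (φ ∨f ψ)

Head : ∀ {x φ} → Disj x φ → List Fm
Head dvar = []
Head (dimp {α} _ d) = α ∷ Head d
Head (dside _ d) = Head d
Head (dor d e) = Head d ++ Head e

Side : ∀ {x φ} → Disj x φ → List Fm
Side dvar = []
Side (dimp _ d) = Side d
Side (dside {β} _ d) = β ∷ Side d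
Side (dor d e) = Side d ++ Side e

module Sem {c ℓ₁ ℓ₂ : Level} (H : HeytingAlgebra c ℓ₁ ℓ₂) where
  open HeytingAlgebra H

  ⟦_⟧ : Fm → (ℕ → Carrier) → Carrier
  ⟦ var n ⟧ ρ = ρ n
  ⟦ ⊤f ⟧ ρ = ⊤
  ⟦ ⊥f ⟧ ρ = ⊥
  ⟦ a ∧f b ⟧ ρ = ⟦ a ⟧ ρ ∧ ⟦ b ⟧ ρ
  ⟦ a ∨f b ⟧ ρ = ⟦ a ⟧ ρ ∨ ⟦ b ⟧ ρ
  ⟦ a ⇒f b ⟧ ρ = ⟦ a ⟧ ρ ⇨ ⟦ b ⟧ ρ

  _[_↦_] : (ℕ → Carrier) → ℕ → Carrier → (ℕ → Carrier)
  (ρ [ x ↦ h ]) n with n ≟ x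
  ... | yes _ = h
  ... | no _  = ρ n

  ⋀⟦_⟧ : List Fm → (ℕ → Carrier) → Carrier
  ⋀⟦ as ⟧ ρ = foldr (λ a r → ⟦ a ⟧ ρ ∧ r) ⊤ as

  ⋁⟦_⟧ : List Fm → (ℕ → Carrier) → Carrier
  ⋁⟦ bs ⟧ ρ = foldr (λ b r → ⟦ b ⟧ ρ ∨ r) ⊥ bs

  IsLeastFixedPoint : (Carrier → Carrier) → Carrier → Set (c Level.⊔ ℓ₁ Level.⊔ ℓ₂)
  IsLeastFixedPoint f m = (f m ≈ m) Data.Product.× (∀ d → f d ≤ d → m ≤ d)
    where import Data.Product

-- Let a be the meet of the heads and b the join of the sides of a parse of φ, and F h = φ(h/x).
-- Induction on the parse gives b ≤ F h, h ≤ F h and F h ≤ a ⇨ (b ∨ h), and also that every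
-- prefixed point p of F satisfies a ⇨ p ≤ p.  Hence the prefixed points of F are exactly the p
-- with b ≤ p and a ⇨ p ≤ p, the least of which is a ⇨ b; since F is inflationary, its least
-- prefixed point is a fixed point.
module Submission where

open import Defs
open import Level using (Level)
open import Data.Nat using (ℕ; _≟_)
open import Data.List using (List; []; _∷_; _++_; foldr)
open import Data.Product using (_×_; _,_)
open import Data.Empty using (⊥-elim)
open import Function using (_∘_)
open import Relation.Nullary using (¬_; yes; no)
open import Relation.Binary.PropositionalEquality as ≡ using (_≡_; cong₂)
open import Relation.Binary.Lattice using (HeytingAlgebra; BoundedJoinSemilattice)

module BigJoin {c ℓ₁ ℓ₂ a} (J : BoundedJoinSemilattice c ℓ₁ ℓ₂)
               {A : Set a} (f : A → BoundedJoinSemilattice.Carrier J) where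
  open BoundedJoinSemilattice J
  open import Relation.Binary.Lattice.Properties.BoundedJoinSemilattice J using (identityˡ)
  open import Relation.Binary.Lattice.Properties.JoinSemilattice joinSemilattice
    using (∨-cong; ∨-assoc)

  ⨆ : List A → Carrier
  ⨆ = foldr (λ a r → f a ∨ r) ⊥

  ⨆-++ : ∀ xs ys → ⨆ (xs ++ ys) ≈ ⨆ xs ∨ ⨆ ys
  ⨆-++ []       ys = Eq.sym (identityˡ _)
  ⨆-++ (a ∷ xs) ys = Eq.trans (∨-cong Eq.refl (⨆-++ xs ys)) (Eq.sym (∨-assoc _ _ _))

module Semantics {c ℓ₁ ℓ₂ : Level} (H : HeytingAlgebra c ℓ₁ ℓ₂) where
  open HeytingAlgebra H
  open Sem H
  open import Relation.Binary.Lattice.Properties.BoundedMeetSemilattice boundedMeetSemilattice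
    using (dualBoundedJoinSemilattice)
  open import Relation.Binary.Lattice.Properties.HeytingAlgebra H
    using (⇨-eval; y≤x⇨y; ⇨ʳ-covariant; ⇨-relax; ⇨-curry)
  open import Relation.Binary.Lattice.Properties.MeetSemilattice meetSemilattice
    using (∧-assoc; ∧-monotonic)
  open import Relation.Binary.Lattice.Properties.JoinSemilattice joinSemilattice
    using (∨-monotonic)

  ⋀⟦⟧-++ : ∀ ρ xs ys → ⋀⟦ xs ++ ys ⟧ ρ ≈ ⋀⟦ xs ⟧ ρ ∧ ⋀⟦ ys ⟧ ρ
  ⋀⟦⟧-++ ρ = BigJoin.⨆-++ dualBoundedJoinSemilattice (λ a → ⟦ a ⟧ ρ)

  ⋁⟦⟧-++ : ∀ ρ xs ys → ⋁⟦ xs ++ ys ⟧ ρ ≈ ⋁⟦ xs ⟧ ρ ∨ ⋁⟦ ys ⟧ ρ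
  ⋁⟦⟧-++ ρ = BigJoin.⨆-++ boundedJoinSemilattice (λ b → ⟦ b ⟧ ρ)

  update-same : ∀ ρ x h → (ρ [ x ↦ h ]) x ≡ h
  update-same ρ x h with x ≟ x
  ... | yes _  = ≡.refl
  ... | no x≢x = ⊥-elim (x≢x ≡.refl)

  ⟦⟧-update-fresh : ∀ {x} ρ h α → ¬ Occurs x α → ⟦ α ⟧ (ρ [ x ↦ h ]) ≡ ⟦ α ⟧ ρ
  ⟦⟧-update-fresh {x} ρ h (var n) x∉ with n ≟ x
  ... | yes ≡.refl = ⊥-elim (x∉ here)
  ... | no _       = ≡.refl
  ⟦⟧-update-fresh ρ h ⊤f       x∉ = ≡.refl
  ⟦⟧-update-fresh ρ h ⊥f       x∉ = ≡.refl
  ⟦⟧-update-fresh ρ h (a ∧f b) x∉ =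
    cong₂ _∧_ (⟦⟧-update-fresh ρ h a (x∉ ∘ ∧l)) (⟦⟧-update-fresh ρ h b (x∉ ∘ ∧r))
  ⟦⟧-update-fresh ρ h (a ∨f b) x∉ =
    cong₂ _∨_ (⟦⟧-update-fresh ρ h a (x∉ ∘ ∨l)) (⟦⟧-update-fresh ρ h b (x∉ ∘ ∨r))
  ⟦⟧-update-fresh ρ h (a ⇒f b) x∉ =
    cong₂ _⇨_ (⟦⟧-update-fresh ρ h a (x∉ ∘ ⇒l)) (⟦⟧-update-fresh ρ h b (x∉ ∘ ⇒r))

  ⇨-contract : ∀ {a b} → a ⇨ (a ⇨ b) ≤ a ⇨ b
  ⇨-contract = trans (reflexive (Eq.sym ⇨-curry)) (⇨-relax (∧-greatest refl refl) refl)

  ⇨-∨-relax : ∀ {a a′ b b′ h} → a′ ≤ a → b ≤ b′ → a ⇨ b ∨ h ≤ a′ ⇨ b′ ∨ h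
  ⇨-∨-relax a′≤a b≤b′ = ⇨-relax a′≤a (∨-monotonic b≤b′ refl)

  module Parse (x : ℕ) (ρ : ℕ → Carrier) where

    F : Fm → Carrier → Carrier
    F φ h = ⟦ φ ⟧ (ρ [ x ↦ h ])

    ⋀Head ⋁Side : ∀ {φ} → Disj x φ → Carrier
    ⋀Head d = ⋀⟦ Head d ⟧ ρ
    ⋁Side d = ⋁⟦ Side d ⟧ ρ

    F-inflationary : ∀ {φ} (d : Disj x φ) h → h ≤ F φ h
    F-inflationary dvar        h rewrite update-same ρ x h = refl
    F-inflationary (dimp _ d)  h = trans (F-inflationary d h) y≤x⇨y
    F-inflationary (dside _ d) h = trans (F-inflationary d h) (y≤x∨y _ _)
    F-inflationary (dor d _)   h = trans (F-inflationary d h) (x≤x∨y _ _)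

    ⋁Side≤F : ∀ {φ} (d : Disj x φ) h → ⋁Side d ≤ F φ h
    ⋁Side≤F dvar              h = minimum _
    ⋁Side≤F (dimp _ d)        h = trans (⋁Side≤F d h) y≤x⇨y
    ⋁Side≤F (dside {β} x∉ d)  h rewrite ⟦⟧-update-fresh ρ h β x∉ = ∨-monotonic refl (⋁Side≤F d h)
    ⋁Side≤F (dor d e)         h =
      trans (reflexive (⋁⟦⟧-++ ρ (Side d) (Side e))) (∨-monotonic (⋁Side≤F d h) (⋁Side≤F e h))

    F≤⋀Head⇨⋁Side∨ : ∀ {φ} (d : Disj x φ) h → F φ h ≤ ⋀Head d ⇨ ⋁Side d ∨ h
    F≤⋀Head⇨⋁Side∨ dvar h rewrite update-same ρ x h = trans (y≤x∨y _ _) y≤x⇨y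
    F≤⋀Head⇨⋁Side∨ (dimp {α} x∉ d) h rewrite ⟦⟧-update-fresh ρ h α x∉ =
      trans (⇨ʳ-covariant (F≤⋀Head⇨⋁Side∨ d h)) (reflexive (Eq.sym ⇨-curry))
    F≤⋀Head⇨⋁Side∨ (dside {β} x∉ d) h rewrite ⟦⟧-update-fresh ρ h β x∉ =
      ∨-least (trans (trans (x≤x∨y _ _) (x≤x∨y _ _)) y≤x⇨y)
              (trans (F≤⋀Head⇨⋁Side∨ d h) (⇨ʳ-covariant (∨-monotonic (y≤x∨y _ _) refl)))
    F≤⋀Head⇨⋁Side∨ (dor d e) h = ∨-least
      (trans (F≤⋀Head⇨⋁Side∨ d h) (⇨-∨-relax (trans heads (x∧y≤x _ _)) (trans (x≤x∨y _ _) sides)))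
      (trans (F≤⋀Head⇨⋁Side∨ e h) (⇨-∨-relax (trans heads (x∧y≤y _ _)) (trans (y≤x∨y _ _) sides)))
      where
        heads : ⋀Head (dor d e) ≤ ⋀Head d ∧ ⋀Head e
        heads = reflexive (⋀⟦⟧-++ ρ (Head d) (Head e))
        sides : ⋁Side d ∨ ⋁Side e ≤ ⋁Side (dor d e)
        sides = reflexive (Eq.sym (⋁⟦⟧-++ ρ (Side d) (Side e)))

    -- The premise c accumulates heads already passed.  At φ ∨ ψ the heads cannot be split by
    -- distributivity (a ∧ a′ ⇨ p ≰ (a ⇨ p) ∨ (a′ ⇨ p) in general); they are discharged in turn,
    -- using a ∧ a′ ⇨ p ≈ a ⇨ (a′ ⇨ p).
    ∧⋀Head⇨≤ : ∀ {φ} (d : Disj x φ) c p → c ⇨ F φ p ≤ p → c ∧ ⋀Head d ⇨ p ≤ p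
    ∧⋀Head⇨≤ dvar c p c⇨Fp≤p rewrite update-same ρ x p =
      trans (⇨-relax (∧-greatest refl (maximum _)) refl) c⇨Fp≤p
    ∧⋀Head⇨≤ (dimp {α} x∉ d) c p c⇨Fp≤p rewrite ⟦⟧-update-fresh ρ p α x∉ =
      trans (⇨-relax (reflexive (∧-assoc _ _ _)) refl)
            (∧⋀Head⇨≤ d (c ∧ ⟦ α ⟧ ρ) p (trans (reflexive ⇨-curry) c⇨Fp≤p))
    ∧⋀Head⇨≤ (dside _ d) c p c⇨Fp≤p =
      ∧⋀Head⇨≤ d c p (trans (⇨ʳ-covariant (y≤x∨y _ _)) c⇨Fp≤p)
    ∧⋀Head⇨≤ {φ ∨f ψ} (dor d e) c p c⇨Fp≤p =
      trans (⇨-relax heads refl) (∧⋀Head⇨≤ e (c ∧ ⋀Head d) p (trans (⇨ʳ-covariant Fψp≤p) c∧⋀Hd⇨p≤p))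
      where
        c∧⋀Hd⇨p≤p : c ∧ ⋀Head d ⇨ p ≤ p
        c∧⋀Hd⇨p≤p = ∧⋀Head⇨≤ d c p (trans (⇨ʳ-covariant (x≤x∨y _ _)) c⇨Fp≤p)
        Fψp≤p : F ψ p ≤ p
        Fψp≤p = trans y≤x⇨y (trans (⇨ʳ-covariant (y≤x∨y _ _)) c⇨Fp≤p)
        heads : (c ∧ ⋀Head d) ∧ ⋀Head e ≤ c ∧ ⋀Head (dor d e)
        heads = trans (reflexive (∧-assoc _ _ _))
                      (∧-monotonic refl (reflexive (Eq.sym (⋀⟦⟧-++ ρ (Head d) (Head e)))))

    prefixed⇒ : ∀ {φ} (d : Disj x φ) p → F φ p ≤ p → ⋁Side d ≤ p × ⋀Head d ⇨ p ≤ p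
    prefixed⇒ {φ} d p Fp≤p =
      trans (⋁Side≤F d p) Fp≤p ,
      trans (⇨-relax (x∧y≤y _ _) refl) (∧⋀Head⇨≤ d ⊤ p (trans ⊤⇨Fp≤Fp Fp≤p))
      where
        ⊤⇨Fp≤Fp : ⊤ ⇨ F φ p ≤ F φ p
        ⊤⇨Fp≤Fp = trans (∧-greatest refl (maximum _)) ⇨-eval

    prefixed⇐ : ∀ {φ} (d : Disj x φ) p → ⋁Side d ≤ p → ⋀Head d ⇨ p ≤ p → F φ p ≤ p
    prefixed⇐ d p ⋁Side≤p ⋀Head⇨p≤p =
      trans (F≤⋀Head⇨⋁Side∨ d p) (trans (⇨ʳ-covariant (∨-least ⋁Side≤p refl)) ⋀Head⇨p≤p)

proposition5p6 : ∀ {c ℓ₁ ℓ₂ : Level} (H : HeytingAlgebra c ℓ₁ ℓ₂)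
    (x : ℕ) (φ : Fm) (d : Disj x φ) (ρ : ℕ → HeytingAlgebra.Carrier H) →
    Sem.IsLeastFixedPoint H (λ h → Sem.⟦ H ⟧ φ (Sem._[_↦_] H ρ x h))
      (HeytingAlgebra._⇨_ H (Sem.⋀⟦ H ⟧ (Head d) ρ) (Sem.⋁⟦ H ⟧ (Side d) ρ))
proposition5p6 H x φ d ρ = antisym Fm≤m (F-inflationary d m) , m≤prefixed
  where
    open HeytingAlgebra H
    open Semantics H
    open Parse x ρ
    open import Relation.Binary.Lattice.Properties.HeytingAlgebra H using (y≤x⇨y; ⇨ʳ-covariant)

    m : Carrier
    m = ⋀Head d ⇨ ⋁Side d

    Fm≤m : F φ m ≤ m
    Fm≤m = prefixed⇐ d m y≤x⇨y ⇨-contract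

    m≤prefixed : ∀ p → F φ p ≤ p → m ≤ p
    m≤prefixed p Fp≤p with prefixed⇒ d p Fp≤p
    ... | ⋁Side≤p , ⋀Head⇨p≤p = trans (⇨ʳ-covariant ⋁Side≤p) ⋀Head⇨p≤p
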